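{- Let $r,\gamma,n$ be positive integers with $n\ge\gamma\ge r+1>2$, and let $f\colon\mathbb{N}\to\mathbb{R}_+$ be a positive-valued function. Then the optimum value of the linear program \[\min_{x_2,\dots,x_r,y_2,\dots,y_r}\ \sum_{j=2}^r (x_j-y_j)f(n-j+1)\] subject to $0\le y_j\le x_j$ for all $j\in\{2,\dots,r\}$, $\sum_{j=2}^r x_j=1$, and $\gamma\sum_{j=2}^r y_j\le\sum_{j=2}^r j\,x_j$, is \[\min_{2\le j\le r}\left(1-\frac{j}{\gamma-r+j}\right)f(n-j+1).\] -}

module Defs where

open import Level using (Level; suc; _⊔_)
open import Data.Nat as ℕ using (ℕ; zero; _∸_)
open import Data.List using (List; []; _∷_; map; upTo; foldr)
open import Data.Product using (Σ; _×_; ∃-syntax)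
open import Relation.Nullary using (¬_)
open import Relation.Binary using (Rel; IsTotalOrder)
open import Algebra.Bundles using (CommutativeRing)

-- An ordered field (the standard first-order axioms): a commutative ring
-- with a total order compatible with + and *, 1 ≠ 0, and a
-- multiplicative inverse for every nonzero element.  ℝ is a model.
record OrderedField (c ℓ₁ ℓ₂ : Level) : Set (Level.suc (c ⊔ ℓ₁ ⊔ ℓ₂)) where
  field
    commutativeRing : CommutativeRing c ℓ₁
  open CommutativeRing commutativeRing public
  field
    _≤_          : Rel Carrier ℓ₂
    isTotalOrder : IsTotalOrder _≈_ _≤_
    +-mono-≤     : ∀ {x y} z → x ≤ y → (x + z) ≤ (y + z)
    *-nonneg     : ∀ {x y} → 0# ≤ x → 0# ≤ y → 0# ≤ (x * y)
    1≉0          : ¬ (1# ≈ 0#)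
    _⁻¹          : Carrier → Carrier
    ⁻¹-inverse   : ∀ x → ¬ (x ≈ 0#) → (x * (x ⁻¹)) ≈ 1#

  infix 4 _<_
  _<_ : Carrier → Carrier → Set (ℓ₁ ⊔ ℓ₂)
  x < y = (x ≤ y) × ¬ (x ≈ y)

  ι : ℕ → Carrier
  ι zero = 0#
  ι (ℕ.suc n) = 1# + ι n

-- the list [a, a+1, ..., b]  (empty if b < a)
range : ℕ → ℕ → List ℕ
range a b = map (a ℕ.+_) (upTo ((ℕ.suc b) ∸ a))

module LP {c ℓ₁ ℓ₂} (F : OrderedField c ℓ₁ ℓ₂) where
  open OrderedField F

  Σ[_,_] : ℕ → ℕ → (ℕ → Carrier) → Carrier
  Σ[ a , b ] g = foldr (λ j s → g j + s) 0# (range a b)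

  InRange : ℕ → ℕ → Set
  InRange r j = (2 ℕ.≤ j) × (j ℕ.≤ r)

  -- feasibility of (x_2..x_r, y_2..y_r); only the values at j ∈ {2..r} matter
  Feasible : (r γ : ℕ) → (x y : ℕ → Carrier) → Set (ℓ₁ ⊔ ℓ₂)
  Feasible r γ x y =
      (∀ j → InRange r j → (0# ≤ y j) × (y j ≤ x j))
    × (Σ[ 2 , r ] x ≈ 1#)
    × ((ι γ * Σ[ 2 , r ] y) ≤ Σ[ 2 , r ] (λ j → ι j * x j))

  objective : (f : ℕ → Carrier) (n r : ℕ) (x y : ℕ → Carrier) → Carrier
  objective f n r x y = Σ[ 2 , r ] (λ j → (x j - y j) * f (n ∸ j ℕ.+ 1))

  IsOptimum : (f : ℕ → Carrier) (n r γ : ℕ) → Carrier → Set (c ⊔ ℓ₁ ⊔ ℓ₂)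
  IsOptimum f n r γ V =
      (∃[ x ] ∃[ y ] (Feasible r γ x y × (objective f n r x y ≈ V)))
    × (∀ x y → Feasible r γ x y → V ≤ objective f n r x y)

  value : (f : ℕ → Carrier) (n r γ j : ℕ) → Carrier
  value f n r γ j = (1# - (ι j * (ι (γ ∸ r ℕ.+ j)) ⁻¹)) * f (n ∸ j ℕ.+ 1)

  IsMinOver : (r : ℕ) (g : ℕ → Carrier) → Carrier → Set (ℓ₁ ⊔ ℓ₂)
  IsMinOver r g V = (∃[ j ] (InRange r j × (V ≈ g j))) × (∀ j → InRange r j → V ≤ g j)

  Theorem : Set (c ⊔ ℓ₁ ⊔ ℓ₂)
  Theorem = (r γ n : ℕ) → 0 ℕ.< r → 0 ℕ.< γ → 0 ℕ.< n →
            γ ℕ.≤ n → r ℕ.+ 1 ℕ.≤ γ → 2 ℕ.< r ℕ.+ 1 →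
            (f : ℕ → Carrier) → (∀ k → 0# < f k) →
            (V : Carrier) → IsMinOver r (value f n r γ) V →
            IsOptimum f n r γ V

module Submission where

-- The linear program  min Σ_{j=2}^r (x_j - y_j) f_j  over
--   0 ≤ y_j ≤ x_j,   Σ x_j = 1,   γ Σ y_j ≤ Σ j x_j      (f_j = f(n-j+1) > 0)
-- has optimum  V = min_j (1 - j/(s+j)) f_j = min_j s f_j/(s+j),  where s = γ - r > 0.
--
-- Lower bound (weak duality).  V(s+j) ≤ s f_j for every j, so multiplying the
-- constraints by the dual weights V gives, for every feasible (x,y),
--   V s ≤ V (s Σx + Σ j x_j - γ Σ y) = V Σ ((s+j) x_j - γ y_j)
--       ≤ Σ V(s+j)(x_j - y_j) ≤ s · objective,
-- using γ ≥ s+j and y ≥ 0; dividing by s > 0 gives V ≤ objective.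
-- Attainment.  If j₀ realises the minimum, put x = (s e_{j₀} + j₀ e_r)/(s+j₀)
-- and y = j₀ e_r/(s+j₀); the γ-constraint then holds with equality and the
-- objective is s f_{j₀}/(s+j₀) = V.

open import Defs
open import Data.Nat as ℕ using (ℕ; zero; suc; _∸_)
import Data.Nat.Properties as ℕP
open import Data.Integer as ℤ using (ℤ; +_; -[1+_])
import Data.Integer.Properties as ℤP
open import Data.Sign as Sign using (Sign)
open import Data.Maybe using (Maybe; just; nothing)
open import Data.Product using (_×_; _,_; proj₁; ∃-syntax)
open import Data.Sum using (inj₁; inj₂)
open import Data.List using (List; []; _∷_; foldr)
open import Data.List.Membership.Propositional using (_∈_)
open import Data.List.Membership.Propositional.Properties using (∈-map⁺; ∈-map⁻; ∈-upTo⁺; ∈-upTo⁻)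
open import Data.List.Relation.Unary.Any using (here; there)
open import Data.List.Relation.Unary.All using (All; []; _∷_; lookup)
open import Data.List.Relation.Unary.Unique.Propositional using (Unique; []; _∷_)
import Data.List.Relation.Unary.Unique.Propositional.Properties as Unique
open import Relation.Nullary using (¬_; yes; no; contradiction)
open import Relation.Binary using (Poset; IsTotalOrder)
import Relation.Binary.Reasoning.PartialOrder
import Relation.Binary.Reasoning.Setoid
import Relation.Binary.PropositionalEquality as P
open P using (_≢_)
open import Algebra.Bundles using (CommutativeRing)
import Algebra.Solver.Ring.AlmostCommutativeRing as ACR

-- A ring solver for any commutative ring R, with ℤ as coefficient ring.
-- It needs the canonical homomorphism ℤ → R (n ↦ n·1).
module IntegerCoefficientSolver {c ℓ} (R : CommutativeRing c ℓ) where
  open CommutativeRing R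
  open import Algebra.Properties.Ring ring using (-1*x≈-x; -‿distribʳ-*; -‿+-comm; -‿involutive; -0#≈0#)
  open import Algebra.Properties.Semiring.Mult semiring using (×-homo-+; ×1-homo-*) renaming (_×_ to _·_)
  open import Relation.Binary.Reasoning.Setoid setoid

  fromℤ : ℤ → Carrier
  fromℤ (+ n)      = n · 1#
  fromℤ (-[1+ n ]) = - (suc n · 1#)

  private
    cancel-+ : ∀ k a b → (k + a) - (k + b) ≈ a - b
    cancel-+ k a b = begin
      (k + a) + - (k + b)   ≈⟨ +-congˡ (sym (-‿+-comm k b)) ⟩
      (k + a) + (- k + - b) ≈⟨ +-assoc k a _ ⟩
      k + (a + (- k + - b)) ≈⟨ +-congˡ (trans (sym (+-assoc a _ _)) (+-congʳ (+-comm a (- k)))) ⟩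
      k + ((- k + a) + - b) ≈⟨ +-congˡ (+-assoc (- k) a _) ⟩
      k + (- k + (a - b))   ≈⟨ sym (+-assoc k _ _) ⟩
      (k + - k) + (a - b)   ≈⟨ +-congʳ (-‿inverseʳ k) ⟩
      0# + (a - b)          ≈⟨ +-identityˡ _ ⟩
      a - b                 ∎

    ⊖-homo : ∀ m n → fromℤ (m ℤ.⊖ n) ≈ m · 1# - n · 1#
    ⊖-homo m zero = begin
      fromℤ (m ℤ.⊖ 0)    ≡⟨ P.cong fromℤ (ℤP.⊖-≥ {m} ℕ.z≤n) ⟩
      m · 1#         ≈⟨ sym (+-identityʳ _) ⟩
      m · 1# + 0#    ≈⟨ +-congˡ (sym -0#≈0#) ⟩
      m · 1# - 0#    ∎
    ⊖-homo zero (suc n) = sym (+-identityˡ _)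
    ⊖-homo (suc m) (suc n) = begin
      fromℤ (suc m ℤ.⊖ suc n)   ≡⟨ P.cong fromℤ (ℤP.[1+m]⊖[1+n]≡m⊖n m n) ⟩
      fromℤ (m ℤ.⊖ n)           ≈⟨ ⊖-homo m n ⟩
      m · 1# - n · 1#       ≈⟨ sym (cancel-+ 1# _ _) ⟩
      suc m · 1# - suc n · 1# ∎

    +-homo : ∀ i j → fromℤ (i ℤ.+ j) ≈ fromℤ i + fromℤ j
    +-homo -[1+ m ] -[1+ n ] = begin
      - (suc (suc (m ℕ.+ n)) · 1#)          ≡⟨ P.cong (λ k → - (k · 1#)) (P.cong suc (P.sym (ℕP.+-suc m n))) ⟩
      - ((suc m ℕ.+ suc n) · 1#)            ≈⟨ -‿cong (×-homo-+ 1# (suc m) (suc n)) ⟩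
      - (suc m · 1# + suc n · 1#)           ≈⟨ sym (-‿+-comm _ _) ⟩
      - (suc m · 1#) + - (suc n · 1#)       ∎
    +-homo -[1+ m ] (+ n) = trans (⊖-homo n (suc m)) (+-comm _ _)
    +-homo (+ m) -[1+ n ] = ⊖-homo m (suc n)
    +-homo (+ m) (+ n)    = ×-homo-+ 1# m n

    -‿homo : ∀ i → fromℤ (ℤ.- i) ≈ - fromℤ i
    -‿homo -[1+ n ]     = sym (-‿involutive _)
    -‿homo (+ zero)     = sym -0#≈0#
    -‿homo (+ suc n)    = refl

    -- multiplicativity is checked through the decomposition  i = sign i · |i|
    sign : Sign → Carrier
    sign Sign.+ = 1#
    sign Sign.- = - 1#

    ◃-homo : ∀ s n → fromℤ (s ℤ.◃ n) ≈ sign s * n · 1#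
    ◃-homo s       zero    = sym (zeroʳ _)
    ◃-homo Sign.+ (suc n)  = sym (*-identityˡ _)
    ◃-homo Sign.- (suc n)  = sym (-1*x≈-x _)

    sign-abs : ∀ i → fromℤ i ≈ sign (ℤ.sign i) * ℤ.∣ i ∣ · 1#
    sign-abs i = trans (reflexive (P.cong fromℤ (P.sym (ℤP.◃-inverse i)))) (◃-homo (ℤ.sign i) ℤ.∣ i ∣)

    sign-homo : ∀ s t → sign (s Sign.* t) ≈ sign s * sign t
    sign-homo Sign.+ Sign.+ = sym (*-identityˡ _)
    sign-homo Sign.+ Sign.- = sym (*-identityˡ _)
    sign-homo Sign.- Sign.+ = sym (*-identityʳ _)
    sign-homo Sign.- Sign.- = begin
      1#                ≈⟨ sym (-‿involutive _) ⟩
      - - 1#            ≈⟨ -‿cong (sym (-1*x≈-x _)) ⟩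
      - (- 1# * 1#)     ≈⟨ -‿distribʳ-* _ _ ⟩
      - 1# * - 1#       ∎

    interchange : ∀ a b c d → (a * b) * (c * d) ≈ (a * c) * (b * d)
    interchange a b c d = begin
      (a * b) * (c * d) ≈⟨ *-assoc a b _ ⟩
      a * (b * (c * d)) ≈⟨ *-congˡ (trans (sym (*-assoc b c d)) (*-congʳ (*-comm b c))) ⟩
      a * ((c * b) * d) ≈⟨ *-congˡ (*-assoc c b d) ⟩
      a * (c * (b * d)) ≈⟨ sym (*-assoc a c _) ⟩
      (a * c) * (b * d) ∎

    *-homo : ∀ i j → fromℤ (i ℤ.* j) ≈ fromℤ i * fromℤ j
    *-homo i j = begin
      fromℤ ((s Sign.* t) ℤ.◃ (∣i∣ ℕ.* ∣j∣))    ≈⟨ ◃-homo (s Sign.* t) (∣i∣ ℕ.* ∣j∣) ⟩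
      sign (s Sign.* t) * (∣i∣ ℕ.* ∣j∣) · 1#  ≈⟨ *-cong (sign-homo s t) (×1-homo-* ∣i∣ ∣j∣) ⟩
      (sign s * sign t) * (∣i∣ · 1# * ∣j∣ · 1#) ≈⟨ interchange _ _ _ _ ⟩
      (sign s * ∣i∣ · 1#) * (sign t * ∣j∣ · 1#) ≈⟨ sym (*-cong (sign-abs i) (sign-abs j)) ⟩
      fromℤ i * fromℤ j                           ∎
      where
      s t : Sign
      s = ℤ.sign i
      t = ℤ.sign j
      ∣i∣ ∣j∣ : ℕ
      ∣i∣ = ℤ.∣ i ∣
      ∣j∣ = ℤ.∣ j ∣

  homomorphism : ℤ.+-*-rawRing ACR.-Raw-AlmostCommutative⟶ ACR.fromCommutativeRing R
  homomorphism = record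
    { ⟦_⟧ = fromℤ ; +-homo = +-homo ; *-homo = *-homo ; -‿homo = -‿homo
    ; 0-homo = refl ; 1-homo = +-identityʳ 1# }

  -- equality test on coefficients, used to drop vanishing monomials
  coefficient-≟ : ∀ i j → Maybe (fromℤ i ≈ fromℤ j)
  coefficient-≟ i j with i ℤ.≟ j
  ... | yes i≡j = just (reflexive (P.cong fromℤ i≡j))
  ... | no  _   = nothing

  open import Algebra.Solver.Ring ℤ.+-*-rawRing (ACR.fromCommutativeRing R) homomorphism
    coefficient-≟ public

range-bound : ∀ a b i → i ℕ.< suc b ∸ a → a ℕ.+ i ℕ.≤ b
range-bound a b i i<d = P.subst (ℕ._≤ b) (ℕP.+-comm i a) (ℕP.≤-pred i+a<1+b)
  where
  a≤1+b : a ℕ.≤ suc b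
  a≤1+b = ℕP.<⇒≤ (ℕP.m∸n≢0⇒n<m (λ d≡0 → ℕP.n≮0 (P.subst (i ℕ.<_) d≡0 i<d)))
  i+a<1+b : suc i ℕ.+ a ℕ.≤ suc b
  i+a<1+b = ℕP.m≤o∸n⇒m+n≤o (suc i) a≤1+b i<d

∈-range⁻ : ∀ {a b j} → j ∈ range a b → a ℕ.≤ j × j ℕ.≤ b
∈-range⁻ {a} {b} j∈ with i , i∈ , P.refl ← ∈-map⁻ (a ℕ.+_) j∈ =
  ℕP.m≤m+n a i , range-bound a b i (∈-upTo⁻ i∈)

∈-range⁺ : ∀ {a b j} → a ℕ.≤ j → j ℕ.≤ b → j ∈ range a b
∈-range⁺ {a} {b} {j} a≤j j≤b =
  P.subst (_∈ range a b) (ℕP.m+[n∸m]≡n a≤j) (∈-map⁺ (a ℕ.+_) (∈-upTo⁺ (ℕP.∸-monoˡ-< (ℕ.s≤s j≤b) a≤j)))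

range-unique : ∀ a b → Unique (range a b)
range-unique a b = Unique.map⁺ (ℕP.+-cancelˡ-≡ a _ _) (Unique.upTo⁺ _)

module FiniteSums {c ℓ} (R : CommutativeRing c ℓ) where
  open CommutativeRing R
  open import Relation.Binary.Reasoning.Setoid setoid

  Σ⟨_⟩ : List ℕ → (ℕ → Carrier) → Carrier
  Σ⟨ L ⟩ g = foldr (λ j s → g j + s) 0# L

  Σ-cong : ∀ {g h} L → (∀ j → g j ≈ h j) → Σ⟨ L ⟩ g ≈ Σ⟨ L ⟩ h
  Σ-cong []      g≈h = refl
  Σ-cong (j ∷ L) g≈h = +-cong (g≈h j) (Σ-cong L g≈h)

  Σ-+ : ∀ (g h : ℕ → Carrier) L → Σ⟨ L ⟩ (λ j → g j + h j) ≈ Σ⟨ L ⟩ g + Σ⟨ L ⟩ h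
  Σ-+ g h []      = sym (+-identityʳ 0#)
  Σ-+ g h (j ∷ L) = begin
    (g j + h j) + Σ⟨ L ⟩ (λ j → g j + h j) ≈⟨ +-congˡ (Σ-+ g h L) ⟩
    (g j + h j) + (Σ⟨ L ⟩ g + Σ⟨ L ⟩ h)     ≈⟨ +-assoc (g j) (h j) _ ⟩
    g j + (h j + (Σ⟨ L ⟩ g + Σ⟨ L ⟩ h))     ≈⟨ +-congˡ (trans (sym (+-assoc (h j) _ _)) (+-congʳ (+-comm (h j) _))) ⟩
    g j + ((Σ⟨ L ⟩ g + h j) + Σ⟨ L ⟩ h)     ≈⟨ +-congˡ (+-assoc _ (h j) _) ⟩
    g j + (Σ⟨ L ⟩ g + (h j + Σ⟨ L ⟩ h))     ≈⟨ sym (+-assoc (g j) _ _) ⟩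
    (g j + Σ⟨ L ⟩ g) + (h j + Σ⟨ L ⟩ h)     ∎

  Σ-*ˡ : ∀ k (g : ℕ → Carrier) L → Σ⟨ L ⟩ (λ j → k * g j) ≈ k * Σ⟨ L ⟩ g
  Σ-*ˡ k g []      = sym (zeroʳ k)
  Σ-*ˡ k g (j ∷ L) = trans (+-congˡ (Σ-*ˡ k g L)) (sym (distribˡ k (g j) _))

  δ : ℕ → ℕ → Carrier
  δ k j with k ℕ.≟ j
  ... | yes _ = 1#
  ... | no  _ = 0#

  δ-self : ∀ k → δ k k ≈ 1#
  δ-self k with k ℕ.≟ k
  ... | yes _   = refl
  ... | no  k≢k = contradiction P.refl k≢k

  δ-other : ∀ {k j} → k ≢ j → δ k j ≈ 0#
  δ-other {k} {j} k≢j with k ℕ.≟ j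
  ... | yes k≡j = contradiction k≡j k≢j
  ... | no  _   = refl

  Σ-δ-absent : ∀ {k} (g : ℕ → Carrier) L → All (k ≢_) L → Σ⟨ L ⟩ (λ j → g j * δ k j) ≈ 0#
  Σ-δ-absent g []      []           = refl
  Σ-δ-absent {k} g (j ∷ L) (k≢j ∷ k∉L) = begin
    g j * δ k j + Σ⟨ L ⟩ (λ j → g j * δ k j) ≈⟨ +-cong (*-congˡ (δ-other k≢j)) (Σ-δ-absent g L k∉L) ⟩
    g j * 0# + 0#                             ≈⟨ trans (+-identityʳ _) (zeroʳ _) ⟩
    0#                                        ∎

  Σ-δ : ∀ {k} (g : ℕ → Carrier) L → Unique L → k ∈ L → Σ⟨ L ⟩ (λ j → g j * δ k j) ≈ g k
  Σ-δ {k} g (k ∷ L) (k∉L ∷ _) (here P.refl) = begin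
    g k * δ k k + Σ⟨ L ⟩ (λ j → g j * δ k j) ≈⟨ +-cong (*-congˡ (δ-self k)) (Σ-δ-absent g L k∉L) ⟩
    g k * 1# + 0#                             ≈⟨ trans (+-identityʳ _) (*-identityʳ _) ⟩
    g k                                       ∎
  Σ-δ {k} g (j ∷ L) (j∉L ∷ uL) (there k∈L) = begin
    g j * δ k j + Σ⟨ L ⟩ (λ j → g j * δ k j) ≈⟨ +-cong (*-congˡ (δ-other (λ k≡j → lookup j∉L k∈L (P.sym k≡j)))) (Σ-δ g L uL k∈L) ⟩
    g j * 0# + g k                            ≈⟨ trans (+-congʳ (zeroʳ _)) (+-identityˡ _) ⟩
    g k                                       ∎

  Σ-δ₂ : ∀ {k l} (g h : ℕ → Carrier) L → Unique L → k ∈ L → l ∈ L →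
         Σ⟨ L ⟩ (λ j → g j * δ k j + h j * δ l j) ≈ g k + h l
  Σ-δ₂ g h L uL k∈L l∈L = trans (Σ-+ _ _ L) (+-cong (Σ-δ g L uL k∈L) (Σ-δ h L uL l∈L))

module OrderedFieldProperties {c ℓ₁ ℓ₂} (F : OrderedField c ℓ₁ ℓ₂) where
  open OrderedField F renaming (_≤_ to infix 4 _≤_)
  open IntegerCoefficientSolver commutativeRing public using (solve; _:+_; _:*_; _:-_; :-_; _:=_; con)
  open IsTotalOrder isTotalOrder public using (total; antisym; ≤-respˡ-≈; ≤-respʳ-≈)
    renaming (refl to ≤-refl; reflexive to ≤-reflexive)
  open FiniteSums commutativeRing public

  poset : Poset c ℓ₁ ℓ₂
  poset = record { isPartialOrder = IsTotalOrder.isPartialOrder isTotalOrder }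

  module ≤-Reasoning = Relation.Binary.Reasoning.PartialOrder poset
  module ≈-Reasoning = Relation.Binary.Reasoning.Setoid setoid

  ≤⇒0≤- : ∀ {a b} → a ≤ b → 0# ≤ b - a
  ≤⇒0≤- {a} p = ≤-respˡ-≈ (-‿inverseʳ a) (+-mono-≤ (- a) p)

  0≤-⇒≤ : ∀ {a b} → 0# ≤ b - a → a ≤ b
  0≤-⇒≤ {a} {b} p = ≤-respˡ-≈ (+-identityˡ a) (≤-respʳ-≈ b-a+a≈b (+-mono-≤ a p))
    where
    b-a+a≈b : (b - a) + a ≈ b
    b-a+a≈b = solve 2 (λ a b → (b :- a) :+ a := b) refl a b

  +-mono₂-≤ : ∀ {a b c d} → a ≤ b → c ≤ d → a + c ≤ b + d
  +-mono₂-≤ {a} {b} {c} {d} a≤b c≤d = begin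
    a + c ≤⟨ +-mono-≤ c a≤b ⟩
    b + c ≈⟨ +-comm b c ⟩
    c + b ≤⟨ +-mono-≤ b c≤d ⟩
    d + b ≈⟨ +-comm d b ⟩
    b + d ∎
    where open ≤-Reasoning

  -‿antimonoʳ-≤ : ∀ a {b c} → b ≤ c → a - c ≤ a - b
  -‿antimonoʳ-≤ a {b} {c} b≤c = 0≤-⇒≤ (≤-respʳ-≈ (solve 3 (λ a b c → c :- b := (a :- b) :- (a :- c)) refl a b c) (≤⇒0≤- b≤c))

  *-monoˡ-≤ : ∀ {k a b} → 0# ≤ k → a ≤ b → k * a ≤ k * b
  *-monoˡ-≤ {k} {a} {b} k≥0 a≤b = 0≤-⇒≤ (≤-respʳ-≈ (solve 3 (λ k a b → k :* (b :- a) := k :* b :- k :* a) refl k a b) (*-nonneg k≥0 (≤⇒0≤- a≤b)))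

  *-monoʳ-≤ : ∀ {k a b} → 0# ≤ k → a ≤ b → a * k ≤ b * k
  *-monoʳ-≤ {k} {a} {b} k≥0 a≤b = ≤-respˡ-≈ (*-comm k a) (≤-respʳ-≈ (*-comm k b) (*-monoˡ-≤ k≥0 a≤b))

  0≤1 : 0# ≤ 1#
  0≤1 with total 0# 1#
  ... | inj₁ 0≤1 = 0≤1
  ... | inj₂ 1≤0 = ≤-respʳ-≈ square≈1 (*-nonneg (≤⇒0≤- 1≤0) (≤⇒0≤- 1≤0))
    where
    square≈1 : (0# - 1#) * (0# - 1#) ≈ 1#
    square≈1 = trans (solve 1 (λ o → (con (ℤ.+ 0) :- o) :* (con (ℤ.+ 0) :- o) := o :* o) refl 1#) (*-identityˡ 1#)

  ⁻¹-cancelˡ : ∀ {s} → ¬ (s ≈ 0#) → ∀ a → s ⁻¹ * (s * a) ≈ a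
  ⁻¹-cancelˡ {s} s≉0 a = begin
    s ⁻¹ * (s * a) ≈⟨ solve 3 (λ s w a → w :* (s :* a) := (s :* w) :* a) refl s (s ⁻¹) a ⟩
    (s * s ⁻¹) * a ≈⟨ *-congʳ (⁻¹-inverse s s≉0) ⟩
    1# * a         ≈⟨ *-identityˡ a ⟩
    a              ∎
    where open ≈-Reasoning

  ⁻¹-nonneg : ∀ {s} → 0# ≤ s → ¬ (s ≈ 0#) → 0# ≤ s ⁻¹
  ⁻¹-nonneg {s} s≥0 s≉0 with total 0# (s ⁻¹)
  ... | inj₁ 0≤s⁻¹ = 0≤s⁻¹
  ... | inj₂ s⁻¹≤0 = contradiction (antisym (0≤-⇒≤ (≤-respʳ-≈ s[0-s⁻¹]≈0-1 (*-nonneg s≥0 (≤⇒0≤- s⁻¹≤0)))) 0≤1) 1≉0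
    where
    s[0-s⁻¹]≈0-1 : s * (0# - s ⁻¹) ≈ 0# - 1#
    s[0-s⁻¹]≈0-1 = begin
      s * (0# - s ⁻¹)  ≈⟨ solve 2 (λ s w → s :* (con (ℤ.+ 0) :- w) := con (ℤ.+ 0) :- s :* w) refl s (s ⁻¹) ⟩
      0# - s * s ⁻¹    ≈⟨ +-congˡ (-‿cong (⁻¹-inverse s s≉0)) ⟩
      0# - 1#          ∎
      where open ≈-Reasoning

  *-cancelˡ-≤ : ∀ {s a b} → 0# ≤ s → ¬ (s ≈ 0#) → s * a ≤ s * b → a ≤ b
  *-cancelˡ-≤ {s} {a} {b} s≥0 s≉0 sa≤sb = begin
    a              ≈⟨ ⁻¹-cancelˡ s≉0 a ⟨
    s ⁻¹ * (s * a) ≤⟨ *-monoˡ-≤ (⁻¹-nonneg s≥0 s≉0) sa≤sb ⟩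
    s ⁻¹ * (s * b) ≈⟨ ⁻¹-cancelˡ s≉0 b ⟩
    b              ∎
    where open ≤-Reasoning

  ι-+ : ∀ m n → ι (m ℕ.+ n) ≈ ι m + ι n
  ι-+ zero    n = sym (+-identityˡ _)
  ι-+ (suc m) n = trans (+-congˡ (ι-+ m n)) (sym (+-assoc _ _ _))

  ι-nonneg : ∀ n → 0# ≤ ι n
  ι-nonneg zero    = ≤-refl
  ι-nonneg (suc n) = ≤-respˡ-≈ (+-identityʳ 0#) (+-mono₂-≤ 0≤1 (ι-nonneg n))

  ι-mono : ∀ {m n} → m ℕ.≤ n → ι m ≤ ι n
  ι-mono {m} {n} m≤n = begin
    ι m                  ≈⟨ +-identityʳ (ι m) ⟨
    ι m + 0#             ≤⟨ +-mono₂-≤ ≤-refl (ι-nonneg (n ∸ m)) ⟩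
    ι m + ι (n ∸ m)      ≈⟨ ι-+ m (n ∸ m) ⟨
    ι (m ℕ.+ (n ∸ m))    ≡⟨ P.cong ι (ℕP.m+[n∸m]≡n m≤n) ⟩
    ι n                  ∎
    where open ≤-Reasoning

  ι-pos≉0 : ∀ {n} → 0 ℕ.< n → ¬ (ι n ≈ 0#)
  ι-pos≉0 {n} 0<n ι≈0 = 1≉0 (antisym 1≤0 0≤1)
    where
    open ≤-Reasoning
    1≤0 : 1# ≤ 0#
    1≤0 = begin
      1#   ≈⟨ +-identityʳ 1# ⟨
      ι 1  ≤⟨ ι-mono 0<n ⟩
      ι n  ≈⟨ ι≈0 ⟩
      0#   ∎

  δ-nonneg : ∀ k j → 0# ≤ δ k j
  δ-nonneg k j with k ℕ.≟ j
  ... | yes _ = 0≤1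
  ... | no  _ = ≤-refl

  Σ-mono : ∀ {g h} L → (∀ j → j ∈ L → g j ≤ h j) → Σ⟨ L ⟩ g ≤ Σ⟨ L ⟩ h
  Σ-mono []      g≤h = ≤-refl
  Σ-mono (j ∷ L) g≤h = +-mono₂-≤ (g≤h j (here P.refl)) (Σ-mono L (λ i i∈L → g≤h i (there i∈L)))

module LinearProgram {c ℓ₁ ℓ₂} (F : OrderedField c ℓ₁ ℓ₂) where
  open OrderedField F renaming (_≤_ to infix 4 _≤_)
  open OrderedFieldProperties F
  open LP F
  open import Algebra.Properties.Ring ring using (-‿distribˡ-*)

  complement-ratio : ∀ {a b t} → t ≈ a + b → ¬ (t ≈ 0#) → 1# - b * t ⁻¹ ≈ a * t ⁻¹
  complement-ratio {a} {b} {t} t≈a+b t≉0 = begin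
    1# - b * t ⁻¹              ≈⟨ +-congʳ (sym (⁻¹-inverse t t≉0)) ⟩
    t * t ⁻¹ - b * t ⁻¹        ≈⟨ +-congʳ (*-congʳ t≈a+b) ⟩
    (a + b) * t ⁻¹ - b * t ⁻¹  ≈⟨ solve 3 (λ a b w → (a :+ b) :* w :- b :* w := a :* w) refl a b (t ⁻¹) ⟩
    a * t ⁻¹                   ∎
    where open ≈-Reasoning

  clear-denominator : ∀ {V a b t} → 0# ≤ t → ¬ (t ≈ 0#) → V ≤ (a * t ⁻¹) * b → V * t ≤ a * b
  clear-denominator {V} {a} {b} {t} t≥0 t≉0 V≤ = begin
    V * t                   ≤⟨ *-monoʳ-≤ t≥0 V≤ ⟩
    ((a * t ⁻¹) * b) * t    ≈⟨ solve 4 (λ a w b t → ((a :* w) :* b) :* t := (a :* b) :* (t :* w)) refl a (t ⁻¹) b t ⟩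
    (a * b) * (t * t ⁻¹)    ≈⟨ *-congˡ (⁻¹-inverse t t≉0) ⟩
    (a * b) * 1#            ≈⟨ *-identityʳ (a * b) ⟩
    a * b                   ∎
    where open ≤-Reasoning

  denominator-pos : ∀ s {j} → 0 ℕ.< j → 0 ℕ.< s ℕ.+ j
  denominator-pos s {j} 0<j = ℕP.<-≤-trans 0<j (ℕP.m≤n+m j s)

  value-ratio : ∀ f n r γ {j} → 0 ℕ.< j →
                value f n r γ j ≈ (ι (γ ∸ r) * ι (γ ∸ r ℕ.+ j) ⁻¹) * f (n ∸ j ℕ.+ 1)
  value-ratio f n r γ {j} 0<j =
    *-congʳ (complement-ratio (ι-+ (γ ∸ r) j) (ι-pos≉0 (denominator-pos (γ ∸ r) 0<j)))

  value-nonneg : ∀ f n r γ {j} → (∀ k → 0# ≤ f k) → 0 ℕ.< j → 0# ≤ value f n r γ j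
  value-nonneg f n r γ {j} f≥0 0<j =
    ≤-respʳ-≈ (sym (value-ratio f n r γ 0<j))
      (*-nonneg (*-nonneg (ι-nonneg (γ ∸ r)) s+j⁻¹≥0) (f≥0 _))
    where
    s+j⁻¹≥0 : 0# ≤ ι (γ ∸ r ℕ.+ j) ⁻¹
    s+j⁻¹≥0 = ⁻¹-nonneg (ι-nonneg (γ ∸ r ℕ.+ j)) (ι-pos≉0 (denominator-pos (γ ∸ r) 0<j))

  -- A lower bound V for the j-th candidate is a dual multiplier: V (s + j) ≤ s f(n-j+1).
  below-value : ∀ f n r γ {j V} → 0 ℕ.< j → V ≤ value f n r γ j →
                V * (ι (γ ∸ r) + ι j) ≤ ι (γ ∸ r) * f (n ∸ j ℕ.+ 1)
  below-value f n r γ {j} {V} 0<j V≤value =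
    ≤-respˡ-≈ (*-congˡ (ι-+ (γ ∸ r) j))
      (clear-denominator (ι-nonneg (γ ∸ r ℕ.+ j)) (ι-pos≉0 (denominator-pos (γ ∸ r) 0<j))
        (≤-respʳ-≈ (value-ratio f n r γ 0<j) V≤value))

  shift-bound : ∀ {r γ j} → r ℕ.≤ γ → j ℕ.≤ r → ι (γ ∸ r) + ι j ≤ ι γ
  shift-bound {r} {γ} {j} r≤γ j≤r = begin
    ι (γ ∸ r) + ι j      ≈⟨ ι-+ (γ ∸ r) j ⟨
    ι (γ ∸ r ℕ.+ j)      ≤⟨ ι-mono (ℕP.+-monoʳ-≤ (γ ∸ r) j≤r) ⟩
    ι (γ ∸ r ℕ.+ r)      ≡⟨ P.cong ι (ℕP.m∸n+n≡m r≤γ) ⟩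
    ι γ                  ∎
    where open ≤-Reasoning

  dual-summand : ∀ {V S J Γ φ x y} → 0# ≤ V → 0# ≤ y → y ≤ x → S + J ≤ Γ → V * (S + J) ≤ S * φ →
                 V * ((S + J) * x - Γ * y) ≤ S * ((x - y) * φ)
  dual-summand {V} {S} {J} {Γ} {φ} {x} {y} V≥0 y≥0 y≤x S+J≤Γ V[S+J]≤Sφ = begin
    V * ((S + J) * x - Γ * y)        ≤⟨ *-monoˡ-≤ V≥0 (-‿antimonoʳ-≤ _ (*-monoʳ-≤ y≥0 S+J≤Γ)) ⟩
    V * ((S + J) * x - (S + J) * y)  ≈⟨ solve 4 (λ V T x y → V :* (T :* x :- T :* y) := (V :* T) :* (x :- y)) refl V (S + J) x y ⟩
    (V * (S + J)) * (x - y)          ≤⟨ *-monoʳ-≤ (≤⇒0≤- y≤x) V[S+J]≤Sφ ⟩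
    (S * φ) * (x - y)                ≈⟨ solve 3 (λ S φ z → (S :* φ) :* z := S :* (z :* φ)) refl S φ (x - y) ⟩
    S * ((x - y) * φ)                ∎
    where open ≤-Reasoning

  combination-expand : ∀ S Γ L (x y : ℕ → Carrier) →
                       Σ⟨ L ⟩ (λ j → (S + ι j) * x j - Γ * y j)
                       ≈ S * Σ⟨ L ⟩ x + (Σ⟨ L ⟩ (λ j → ι j * x j) - Γ * Σ⟨ L ⟩ y)
  combination-expand S Γ L x y = begin
    Σ⟨ L ⟩ (λ j → (S + ι j) * x j - Γ * y j)
      ≈⟨ Σ-cong L (λ j → solve 5 (λ S J G x y → (S :+ J) :* x :- G :* y := S :* x :+ (J :* x :+ (:- G) :* y)) refl S (ι j) Γ (x j) (y j)) ⟩
    Σ⟨ L ⟩ (λ j → S * x j + (ι j * x j + (- Γ) * y j))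
      ≈⟨ trans (Σ-+ _ _ L) (+-cong (Σ-*ˡ S x L) (trans (Σ-+ _ _ L) (+-congˡ (Σ-*ˡ (- Γ) y L)))) ⟩
    S * Σ⟨ L ⟩ x + (Σ⟨ L ⟩ (λ j → ι j * x j) + (- Γ) * Σ⟨ L ⟩ y)
      ≈⟨ +-congˡ (+-congˡ (sym (-‿distribˡ-* Γ _))) ⟩
    S * Σ⟨ L ⟩ x + (Σ⟨ L ⟩ (λ j → ι j * x j) - Γ * Σ⟨ L ⟩ y)
      ∎
    where open ≈-Reasoning

  constraint-combination : ∀ S Γ L (x y : ℕ → Carrier) → Σ⟨ L ⟩ x ≈ 1# →
                           Γ * Σ⟨ L ⟩ y ≤ Σ⟨ L ⟩ (λ j → ι j * x j) →
                           S ≤ Σ⟨ L ⟩ (λ j → (S + ι j) * x j - Γ * y j)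
  constraint-combination S Γ L x y Σx≈1 Γ-constraint = begin
    S                              ≈⟨ trans (+-identityʳ (S * 1#)) (*-identityʳ S) ⟨
    S * 1# + 0#                    ≤⟨ +-mono₂-≤ (≤-reflexive (*-congˡ (sym Σx≈1))) (≤⇒0≤- Γ-constraint) ⟩
    S * Σ⟨ L ⟩ x + (Σ⟨ L ⟩ (λ j → ι j * x j) - Γ * Σ⟨ L ⟩ y) ≈⟨ combination-expand S Γ L x y ⟨
    Σ⟨ L ⟩ (λ j → (S + ι j) * x j - Γ * y j) ∎
    where open ≤-Reasoning

  weak-duality : ∀ r γ n f {V S} → 0# ≤ V → 0# ≤ S → ¬ (S ≈ 0#) →
                 (∀ j → InRange r j → S + ι j ≤ ι γ) →
                 (∀ j → InRange r j → V * (S + ι j) ≤ S * f (n ∸ j ℕ.+ 1)) →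
                 ∀ x y → Feasible r γ x y → V ≤ objective f n r x y
  weak-duality r γ n f {V} {S} V≥0 S≥0 S≉0 S+j≤γ multiplier x y (bounds , Σx≈1 , γ-constraint) =
    *-cancelˡ-≤ S≥0 S≉0 (begin
      S * V                                              ≈⟨ *-comm S V ⟩
      V * S                                              ≤⟨ *-monoˡ-≤ V≥0 (constraint-combination S (ι γ) L x y Σx≈1 γ-constraint) ⟩
      V * Σ⟨ L ⟩ (λ j → (S + ι j) * x j - ι γ * y j)     ≈⟨ Σ-*ˡ V _ L ⟨
      Σ⟨ L ⟩ (λ j → V * ((S + ι j) * x j - ι γ * y j))   ≤⟨ Σ-mono L summand ⟩
      Σ⟨ L ⟩ (λ j → S * ((x j - y j) * φ j))             ≈⟨ Σ-*ˡ S _ L ⟩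
      S * objective f n r x y                            ∎)
    where
    open ≤-Reasoning
    L : List ℕ
    L = range 2 r
    φ : ℕ → Carrier
    φ j = f (n ∸ j ℕ.+ 1)
    summand : ∀ j → j ∈ L → V * ((S + ι j) * x j - ι γ * y j) ≤ S * ((x j - y j) * φ j)
    summand j j∈L with bounds j (∈-range⁻ j∈L)
    ... | y≥0 , y≤x = dual-summand V≥0 y≥0 y≤x (S+j≤γ j (∈-range⁻ j∈L)) (multiplier j (∈-range⁻ j∈L))

  -- Attainment: with s = γ - r, t = s + j₀, the point
  --   x = (s/t) e_{j₀} + (j₀/t) e_r,   y = (j₀/t) e_r
  -- is feasible (the γ-constraint is tight) and has objective value equal to the j₀-th candidate.
  value-attained : ∀ {r γ} n f j₀ → r ℕ.≤ γ → InRange r j₀ →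
                   ∃[ x ] ∃[ y ] (Feasible r γ x y × (objective f n r x y ≈ value f n r γ j₀))
  value-attained {r} {γ} n f j₀ r≤γ (2≤j₀ , j₀≤r) = x , y , (bounds , Σx≈1 , γ-constraint) , objective≈
    where
    open ≈-Reasoning
    L : List ℕ
    L = range 2 r
    S t U W : Carrier
    S = ι (γ ∸ r)
    0<j₀ : 0 ℕ.< j₀
    0<j₀ = ℕP.<-≤-trans (ℕ.s≤s ℕ.z≤n) 2≤j₀
    t = ι (γ ∸ r ℕ.+ j₀)
    U = S * t ⁻¹
    W = ι j₀ * t ⁻¹
    t≉0 : ¬ (t ≈ 0#)
    t≉0 = ι-pos≉0 (denominator-pos (γ ∸ r) 0<j₀)
    t⁻¹≥0 : 0# ≤ t ⁻¹
    t⁻¹≥0 = ⁻¹-nonneg (ι-nonneg (γ ∸ r ℕ.+ j₀)) t≉0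

    x y : ℕ → Carrier
    x j = U * δ j₀ j + W * δ r j
    y j = W * δ r j

    unique : Unique L
    unique = range-unique 2 r
    j₀∈L : j₀ ∈ L
    j₀∈L = ∈-range⁺ 2≤j₀ j₀≤r
    r∈L : r ∈ L
    r∈L = ∈-range⁺ (ℕP.≤-trans 2≤j₀ j₀≤r) ℕP.≤-refl

    bounds : ∀ j → InRange r j → (0# ≤ y j) × (y j ≤ x j)
    bounds j _ = *-nonneg W≥0 (δ-nonneg r j) , 0≤-⇒≤ (≤-respʳ-≈ x-y≈ (*-nonneg U≥0 (δ-nonneg j₀ j)))
      where
      U≥0 : 0# ≤ U
      U≥0 = *-nonneg (ι-nonneg (γ ∸ r)) t⁻¹≥0
      W≥0 : 0# ≤ W
      W≥0 = *-nonneg (ι-nonneg j₀) t⁻¹≥0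
      x-y≈ : U * δ j₀ j ≈ x j - y j
      x-y≈ = solve 4 (λ U a W b → U :* a := (U :* a :+ W :* b) :- W :* b) refl U (δ j₀ j) W (δ r j)

    Σx≈1 : Σ[ 2 , r ] x ≈ 1#
    Σx≈1 = begin
      Σ⟨ L ⟩ x             ≈⟨ Σ-δ₂ (λ _ → U) (λ _ → W) L unique j₀∈L r∈L ⟩
      U + W                ≈⟨ distribʳ (t ⁻¹) S (ι j₀) ⟨
      (S + ι j₀) * t ⁻¹    ≈⟨ *-congʳ (ι-+ (γ ∸ r) j₀) ⟨
      t * t ⁻¹             ≈⟨ ⁻¹-inverse t t≉0 ⟩
      1#                   ∎

    γ-constraint : ι γ * Σ[ 2 , r ] y ≤ Σ[ 2 , r ] (λ j → ι j * x j)
    γ-constraint = ≤-reflexive (begin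
      ι γ * Σ⟨ L ⟩ y       ≈⟨ *-cong γ≈S+r (Σ-δ (λ _ → W) L unique r∈L) ⟩
      (S + ι r) * W        ≈⟨ solve 4 (λ S R J w → (S :+ R) :* (J :* w) := J :* (S :* w) :+ R :* (J :* w)) refl S (ι r) (ι j₀) (t ⁻¹) ⟩
      ι j₀ * U + ι r * W   ≈⟨ Σ-δ₂ (λ j → ι j * U) (λ j → ι j * W) L unique j₀∈L r∈L ⟨
      Σ⟨ L ⟩ (λ j → (ι j * U) * δ j₀ j + (ι j * W) * δ r j)
        ≈⟨ Σ-cong L (λ j → solve 5 (λ J U a W b → (J :* U) :* a :+ (J :* W) :* b := J :* (U :* a :+ W :* b)) refl (ι j) U (δ j₀ j) W (δ r j)) ⟩
      Σ⟨ L ⟩ (λ j → ι j * x j) ∎)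
      where
      γ≈S+r : ι γ ≈ S + ι r
      γ≈S+r = trans (reflexive (P.cong ι (P.sym (ℕP.m∸n+n≡m r≤γ)))) (ι-+ (γ ∸ r) r)

    objective≈ : objective f n r x y ≈ value f n r γ j₀
    objective≈ = begin
      Σ⟨ L ⟩ (λ j → (x j - y j) * φ j)
        ≈⟨ Σ-cong L (λ j → solve 5 (λ U a W b F → ((U :* a :+ W :* b) :- W :* b) :* F := (U :* F) :* a) refl U (δ j₀ j) W (δ r j) (φ j)) ⟩
      Σ⟨ L ⟩ (λ j → (U * φ j) * δ j₀ j)   ≈⟨ Σ-δ (λ j → U * φ j) L unique j₀∈L ⟩
      U * φ j₀                            ≈⟨ value-ratio f n r γ 0<j₀ ⟨
      value f n r γ j₀                    ∎
      where
      φ : ℕ → Carrier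
      φ j = f (n ∸ j ℕ.+ 1)

lemma1 : ∀ {c ℓ₁ ℓ₂} (F : OrderedField c ℓ₁ ℓ₂) → LP.Theorem F
lemma1 F r γ n _ _ _ _ r+1≤γ _ f f>0 V ((j₀ , j₀∈ , V≈value) , V≤values) =
  attained , weak-duality r γ n f V≥0 (ι-nonneg s) (ι-pos≉0 (ℕP.m<n⇒0<n∸m r<γ))
                              (λ j (_ , j≤r) → shift-bound r≤γ j≤r)
                              (λ j j∈ → below-value f n r γ (positive j∈) (V≤values j j∈))
  where
  open OrderedField F
  open OrderedFieldProperties F using (ι-nonneg; ι-pos≉0; ≤-respʳ-≈)
  open LP F
  open LinearProgram F
  s : ℕ
  s = γ ∸ r
  r<γ : r ℕ.< γ
  r<γ = P.subst (ℕ._≤ γ) (ℕP.+-comm r 1) r+1≤γ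
  r≤γ : r ℕ.≤ γ
  r≤γ = ℕP.<⇒≤ r<γ
  positive : ∀ {j} → InRange r j → 0 ℕ.< j
  positive (2≤j , _) = ℕP.<-≤-trans (ℕ.s≤s ℕ.z≤n) 2≤j
  V≥0 : 0# ≤ V
  V≥0 = ≤-respʳ-≈ (sym V≈value) (value-nonneg f n r γ (λ k → proj₁ (f>0 k)) (positive j₀∈))
  attained : ∃[ x ] ∃[ y ] (Feasible r γ x y × (objective f n r x y ≈ V))
  attained = retarget (value-attained n f j₀ r≤γ j₀∈)
    where
    retarget : ∃[ x ] ∃[ y ] (Feasible r γ x y × (objective f n r x y ≈ value f n r γ j₀)) →
               ∃[ x ] ∃[ y ] (Feasible r γ x y × (objective f n r x y ≈ V))
    retarget (x , y , feasible , objective≈value) = x , y , feasible , trans objective≈value (sym V≈value)
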